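{- Let $n$ and $m$ be integers with $0\le m<n-1$, let $G$ be a graph of order $n^2-m$, and let $\Delta$ be the maximum degree of a vertex of $G$. If $\Delta\ge n^2-n$, then $N(G,n)\le 1$. Otherwise \[ N(G,n)\le \left\lfloor\frac{n^2-m-\Delta-1}{n-m-1}\right\rfloor. \]
   Context: All graphs are finite simple graphs. An $n$-coloring of a graph $G$ is a proper vertex coloring using at most $n$ colors (adjacent vertices receive distinct colors). Two colorings $C_1,C_2$ of $G$ are orthogonal if whenever two distinct vertices share a color in $C_1$, they have distinct colors in $C_2$. A set of pairwise orthogonal $n$-colorings is called a set of mutually orthogonal $n$-colorings, and $N(G,n)$ denotes the maximum size of a set of mutually orthogonal $n$-colorings of $G$. -}

module Defs where

open import Data.Nat using (ℕ; zero; suc; _+_; _⊔_)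
open import Data.Nat.DivMod using (_/_)
open import Data.Bool using (Bool; true; false; if_then_else_)
open import Data.Fin using (Fin)
open import Data.List using (List; map; foldr)
open import Data.Nat.ListAction using (sum)
open import Data.List.Base using (allFin)
open import Relation.Binary.PropositionalEquality using (_≡_; _≢_)

record Graph (v : ℕ) : Set where
  field
    adj   : Fin v → Fin v → Bool
    sym   : ∀ x y → adj x y ≡ adj y x
    irrefl : ∀ x → adj x x ≡ false
open Graph public

degree : ∀ {v} → Graph v → Fin v → ℕ
degree {v} G x = sum (map (λ y → if adj G x y then 1 else 0) (allFin v))

maxDegree : ∀ {v} → Graph v → ℕ
maxDegree {v} G = foldr _⊔_ 0 (map (degree G) (allFin v))

record Coloring {v : ℕ} (G : Graph v) (n : ℕ) : Set where
  field
    col    : Fin v → Fin n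
    proper : ∀ x y → adj G x y ≡ true → col x ≢ col y
open Coloring public

Orthogonal : ∀ {v n} {G : Graph v} → Coloring G n → Coloring G n → Set
Orthogonal {v} C₁ C₂ =
  ∀ (x y : Fin v) → x ≢ y → col C₁ x ≡ col C₁ y → col C₂ x ≢ col C₂ y

MutuallyOrthogonal : ∀ {v n k} {G : Graph v} → (Fin k → Coloring G n) → Set
MutuallyOrthogonal {k = k} C = ∀ (i j : Fin k) → i ≢ j → Orthogonal (C i) (C j)

-- floor division on ℕ (divisor 0 gives 0; never used with 0 below)
_div_ : ℕ → ℕ → ℕ
a div zero = 0
a div suc d = a / suc d

module Submission where

-- Fix a vertex x of maximum
-- degree Δ and suppose k ≥ 2.  Orthogonality to a second colouring j
-- makes every colour class of a colouring i meet each class of j at most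
-- once, so it has at most n vertices; as the n classes of i cover all v
-- vertices, the class of x has at least v − (n − 1)n = n − m vertices.
-- The k sets "class of x in colouring i, minus x" are pairwise disjoint
-- (orthogonality), and disjoint from {x} and from the neighbourhood of x
-- (properness), whence Δ + 1 + k(n − m − 1) ≤ v.  Both claims are
-- arithmetic consequences of this inequality.

open import Defs
open import Data.Nat using (ℕ; _+_; _*_; _∸_; _≤_; _<_)
open import Data.Fin using (Fin)
open import Data.Product using (_×_)

open import Data.Nat using (zero; suc; z≤n; s≤s; _≤?_)
open import Data.Nat.Properties hiding (_≟_)
open import Data.Nat.DivMod using (_/_; m*n/n≡m; /-monoˡ-≤)
open import Data.Fin using (zero; suc; _≟_; punchIn)
open import Data.Fin.Properties using () renaming (suc-injective to fsuc-injective)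
open import Data.Bool using (true; false; if_then_else_)
import Data.Bool as Bool
open import Data.List using (map; tabulate)
open import Data.List.Base using (allFin)
open import Data.List.Properties using (map-tabulate)
open import Data.List.Membership.Propositional.Properties using (foldr-selective; ∈-map⁻)
import Data.Nat.ListAction as List
open import Data.Product using (∃; _,_)
open import Data.Sum using (inj₁; inj₂)
open import Data.Empty using (⊥-elim)
open import Relation.Nullary using (Dec; yes; no; ¬_; contradiction)
open import Relation.Nullary.Decidable using (_×-dec_; ¬?)
open import Relation.Unary using (Decidable)
open import Relation.Binary.PropositionalEquality hiding (sym)
open import Relation.Binary.PropositionalEquality as ≡ using ()
open import Algebra.Properties.CommutativeMonoid.Sum +-0-commutativeMonoid
  using (sum; sum-syntax; sum-cong-≗; sum-replicate-zero; sum-remove; ∑-comm; ∑-distrib-+)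

𝟙 : ∀ {p} {P : Set p} → Dec P → ℕ
𝟙 (yes _) = 1
𝟙 (no _)  = 0

𝟙-yes : ∀ {p} {P : Set p} (d : Dec P) → P → 𝟙 d ≡ 1
𝟙-yes (yes _) _ = refl
𝟙-yes (no ¬p) p = contradiction p ¬p

𝟙-no : ∀ {p} {P : Set p} (d : Dec P) → ¬ P → 𝟙 d ≡ 0
𝟙-no (yes p) ¬p = contradiction p ¬p
𝟙-no (no _)  _  = refl

∑-mono-≤ : ∀ {v} {f g : Fin v → ℕ} → (∀ y → f y ≤ g y) → sum f ≤ sum g
∑-mono-≤ {zero}  f≤g = z≤n
∑-mono-≤ {suc v} f≤g = +-mono-≤ (f≤g zero) (∑-mono-≤ (λ y → f≤g (suc y)))

∑-const : ∀ v c → ∑[ y < v ] c ≡ v * c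
∑-const zero    c = refl
∑-const (suc v) c = cong (c +_) (∑-const v c)

∑-≤-term : ∀ {n} (f : Fin n → ℕ) b → (∀ c → f c ≤ b) → (c : Fin n) →
  sum f ≤ f c + (n ∸ 1) * b
∑-≤-term {suc n} f b f≤b c = begin
  sum f                                ≡⟨ sum-remove {i = c} f ⟩
  f c + sum (λ j → f (punchIn c j))    ≤⟨ +-monoʳ-≤ (f c) (∑-mono-≤ (λ j → f≤b (punchIn c j))) ⟩
  f c + ∑[ j < n ] b                   ≡⟨ cong (f c +_) (∑-const n b) ⟩
  f c + n * b                          ∎
  where open ≤-Reasoning

listSum-allFin : ∀ {v} (f : Fin v → ℕ) → List.sum (map f (allFin v)) ≡ sum f
listSum-allFin {v} f = trans (cong List.sum (map-tabulate (λ y → y) f)) (tabulated f)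
  where
  tabulated : ∀ {w} (g : Fin w → ℕ) → List.sum (tabulate g) ≡ sum g
  tabulated {zero}  g = refl
  tabulated {suc w} g = cong (g zero +_) (tabulated (λ y → g (suc y)))

count : ∀ {v} {P : Fin v → Set} → Decidable P → ℕ
count {v} P? = ∑[ y < v ] 𝟙 (P? y)

count-none : ∀ {v} {P : Fin v → Set} (P? : Decidable P) → (∀ y → ¬ P y) →
  count P? ≡ 0
count-none {v} P? none = trans (sum-cong-≗ (λ y → 𝟙-no (P? y) (none y))) (sum-replicate-zero v)

count-unique : ∀ {v} {P : Fin v → Set} (P? : Decidable P) →
  (∀ {y z} → P y → P z → y ≡ z) → count P? ≤ 1
count-unique {zero}  P? unique = z≤n
count-unique {suc v} P? unique with P? zero
... | yes p = ≤-reflexive (cong suc (count-none (λ y → P? (suc y)) (λ y q → 0≢suc (unique p q))))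
  where
  0≢suc : ∀ {y : Fin v} → zero ≢ suc y
  0≢suc ()
... | no _ = count-unique (λ y → P? (suc y)) (λ p q → fsuc-injective (unique p q))

count-≥1 : ∀ {v} {P : Fin v → Set} (P? : Decidable P) {x} → P x → 1 ≤ count P?
count-≥1 {suc v} P? {x} p = begin
  1                                              ≡⟨ 𝟙-yes (P? x) p ⟨
  𝟙 (P? x)                                       ≤⟨ m≤m+n _ _ ⟩
  𝟙 (P? x) + sum (λ j → 𝟙 (P? (punchIn x j)))    ≡⟨ sum-remove {i = x} (λ y → 𝟙 (P? y)) ⟨
  count P?                                       ∎
  where open ≤-Reasoning

count-one : ∀ {v} {P : Fin v → Set} (P? : Decidable P) {x} → P x →
  (∀ {y z} → P y → P z → y ≡ z) → count P? ≡ 1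
count-one P? p unique = ≤-antisym (count-unique P? unique) (count-≥1 P? p)

count-singleton : ∀ {v} (x : Fin v) → count (_≟ x) ≡ 1
count-singleton x = count-one (_≟ x) refl (λ y≡x z≡x → trans y≡x (≡.sym z≡x))

count-remove : ∀ {v} {P : Fin v → Set} (P? : Decidable P) {x} → P x →
  count P? ≡ 1 + count (λ y → ¬? (y ≟ x) ×-dec P? y)
count-remove {v} {P} P? {x} px = begin
  count P?                                   ≡⟨ sum-cong-≗ split ⟩
  ∑[ y < v ] (𝟙 (y ≟ x) + 𝟙 (¬? (y ≟ x) ×-dec P? y))
    ≡⟨ ∑-distrib-+ (λ y → 𝟙 (y ≟ x)) (λ y → 𝟙 (¬? (y ≟ x) ×-dec P? y)) ⟩
  count (_≟ x) + count (λ y → ¬? (y ≟ x) ×-dec P? y)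
    ≡⟨ cong (_+ count (λ y → ¬? (y ≟ x) ×-dec P? y)) (count-singleton x) ⟩
  1 + count (λ y → ¬? (y ≟ x) ×-dec P? y)    ∎
  where
  open ≡-Reasoning
  split : ∀ y → 𝟙 (P? y) ≡ 𝟙 (y ≟ x) + 𝟙 (¬? (y ≟ x) ×-dec P? y)
  split y with y ≟ x | P? y
  ... | yes y≡x | yes p  = cong suc (≡.sym (𝟙-no (¬? (yes y≡x) ×-dec yes p) (λ (y≢x , _) → y≢x y≡x)))
  ... | yes y≡x | no ¬p  = contradiction (subst P (≡.sym y≡x) px) ¬p
  ... | no y≢x  | yes p   = ≡.sym (𝟙-yes (¬? (no y≢x) ×-dec yes p) (y≢x , p))
  ... | no y≢x  | no ¬p   = ≡.sym (𝟙-no (¬? (no y≢x) ×-dec no ¬p) (λ (_ , p) → ¬p p))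

count-fibres : ∀ {v n} (g : Fin v → Fin n) → ∑[ c < n ] count (λ y → g y ≟ c) ≡ v
count-fibres {v} {n} g = begin
  ∑[ c < n ] ∑[ y < v ] 𝟙 (g y ≟ c)   ≡⟨ ∑-comm (λ y c → 𝟙 (g y ≟ c)) ⟨
  ∑[ y < v ] count (g y ≟_)           ≡⟨ sum-cong-≗ (λ y → count-one (g y ≟_) refl (λ p q → trans (≡.sym p) q)) ⟩
  ∑[ y < v ] 1                         ≡⟨ ∑-const v 1 ⟩
  v * 1                                ≡⟨ *-identityʳ v ⟩
  v                                    ∎
  where open ≡-Reasoning

count-injective : ∀ {v n} {P : Fin v → Set} (P? : Decidable P) (g : Fin v → Fin n) →
  (∀ {y z} → P y → P z → g y ≡ g z → y ≡ z) → count P? ≤ n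
count-injective {v} {n} {P} P? g inj = begin
  ∑[ y < v ] 𝟙 (P? y)                            ≡⟨ sum-cong-≗ fibre ⟨
  ∑[ y < v ] count (λ c → P? y ×-dec (g y ≟ c))  ≡⟨ ∑-comm (λ y c → 𝟙 (P? y ×-dec (g y ≟ c))) ⟩
  ∑[ c < n ] count (λ y → P? y ×-dec (g y ≟ c))  ≤⟨ ∑-mono-≤ (λ c → count-unique _ (meet-once c)) ⟩
  ∑[ c < n ] 1                                   ≡⟨ ∑-const n 1 ⟩
  n * 1                                          ≡⟨ *-identityʳ n ⟩
  n                                              ∎
  where
  open ≤-Reasoning
  fibre : ∀ y → count (λ c → P? y ×-dec (g y ≟ c)) ≡ 𝟙 (P? y)
  fibre y with P? y
  ... | yes p = count-one (λ c → yes p ×-dec (g y ≟ c)) (p , refl)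
                  (λ (_ , e) (_ , e′) → trans (≡.sym e) e′)
  ... | no ¬p = count-none (λ c → no ¬p ×-dec (g y ≟ c)) (λ c (p , _) → ¬p p)
  meet-once : ∀ c {y z} → P y × g y ≡ c → P z × g z ≡ c → y ≡ z
  meet-once c (py , gy) (pz , gz) = inj py pz (trans gy (≡.sym gz))

count-disjoint : ∀ {k v} {P : Fin k → Fin v → Set} (P? : ∀ i → Decidable (P i)) →
  (∀ {i j y} → P i y → P j y → i ≡ j) → ∑[ i < k ] count (P? i) ≤ v
count-disjoint {k} {v} {P} P? disjoint = begin
  ∑[ i < k ] ∑[ y < v ] 𝟙 (P? i y)   ≡⟨ ∑-comm (λ i y → 𝟙 (P? i y)) ⟩
  ∑[ y < v ] count (λ i → P? i y)    ≤⟨ ∑-mono-≤ (λ y → count-unique (λ i → P? i y) disjoint) ⟩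
  ∑[ y < v ] 1                        ≡⟨ ∑-const v 1 ⟩
  v * 1                               ≡⟨ *-identityʳ v ⟩
  v                                   ∎
  where open ≤-Reasoning

-- Among k ≥ 2 indices each one has a different partner; this is where
-- orthogonality enters once there are at least two colourings.
partner : ∀ {k} → 2 ≤ k → (i : Fin k) → ∃ λ j → i ≢ j
partner (s≤s (s≤s _)) zero    = suc zero , λ ()
partner (s≤s (s≤s _)) (suc i) = zero , λ ()

maxDegree-attained : ∀ {v} (G : Graph v) → 0 < v → ∃ λ x → maxDegree G ≤ degree G x
maxDegree-attained {suc v} G _
  with foldr-selective ⊔-sel 0 (map (degree G) (allFin (suc v)))
... | inj₁ Δ≡0 = zero , ≤-trans (≤-reflexive Δ≡0) z≤n
... | inj₂ Δ∈ with ∈-map⁻ (degree G) Δ∈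
...   | x , _ , Δ≡degree = x , ≤-reflexive Δ≡degree

degree-count : ∀ {v} (G : Graph v) (x : Fin v) →
  degree G x ≡ count (λ y → adj G x y Bool.≟ true)
degree-count G x = trans (listSum-allFin (λ y → if adj G x y then 1 else 0)) (sum-cong-≗ indicator)
  where
  indicator : ∀ y → (if adj G x y then 1 else 0) ≡ 𝟙 (adj G x y Bool.≟ true)
  indicator y with adj G x y
  ... | true  = refl
  ... | false = refl

module OrthogonalFamily {v n k : ℕ} {G : Graph v} (C : Fin k → Coloring G n)
                        (orth : MutuallyOrthogonal C) where

  classSize : Fin k → Fin n → ℕ
  classSize i c = count (λ y → col (C i) y ≟ c)

  -- A class of i meets every class of an orthogonal colouring j at most
  -- once, so colouring j is injective on it.
  classSize≤ : ∀ {i j} → i ≢ j → ∀ c → classSize i c ≤ n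
  classSize≤ {i} {j} i≢j c = count-injective _ (col (C j)) injective
    where
    injective : ∀ {y z} → col (C i) y ≡ c → col (C i) z ≡ c →
      col (C j) y ≡ col (C j) z → y ≡ z
    injective {y} {z} cy cz same with y ≟ z
    ... | yes y≡z = y≡z
    ... | no y≢z  = contradiction same (orth i j i≢j y z y≢z (trans cy (≡.sym cz)))

  -- Since the n classes of i cover all v vertices, each of them is large.
  classSize≥ : ∀ {i j} → i ≢ j → ∀ c → v ≤ classSize i c + (n ∸ 1) * n
  classSize≥ {i} i≢j c = begin
    v                             ≡⟨ count-fibres (col (C i)) ⟨
    ∑[ d < n ] classSize i d      ≤⟨ ∑-≤-term (classSize i) n (classSize≤ i≢j) c ⟩
    classSize i c + (n ∸ 1) * n   ∎
    where open ≤-Reasoning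

  mates : Fin k → Fin v → ℕ
  mates i x = count (λ y → ¬? (y ≟ x) ×-dec (col (C i) y ≟ col (C i) x))

  mates≥ : ∀ {i j} → i ≢ j → ∀ x → v ∸ (n ∸ 1) * n ∸ 1 ≤ mates i x
  mates≥ {i} i≢j x = m≤n+o⇒m∸n≤o (v ∸ (n ∸ 1) * n) 1 (m≤n+o⇒m∸n≤o v ((n ∸ 1) * n) (begin
    v                                     ≤⟨ classSize≥ i≢j (col (C i) x) ⟩
    classSize i (col (C i) x) + (n ∸ 1) * n
      ≡⟨ cong (_+ (n ∸ 1) * n) (count-remove (λ y → col (C i) y ≟ col (C i) x) refl) ⟩
    1 + mates i x + (n ∸ 1) * n           ≡⟨ +-comm (1 + mates i x) _ ⟩
    (n ∸ 1) * n + (1 + mates i x)         ∎))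
    where open ≤-Reasoning

  -- The sets {x}, the neighbours of x, and the mates of x in each of the
  -- k colourings are pairwise disjoint: a neighbour has a different
  -- colour than x (properness) and two colourings cannot both give y the
  -- colour of x (orthogonality).
  packing : ∀ x → degree G x + 1 + ∑[ i < k ] mates i x ≤ v
  packing x = begin
    degree G x + 1 + ∑[ i < k ] mates i x
      ≡⟨ cong (_+ ∑[ i < k ] mates i x) (+-comm (degree G x) 1) ⟩
    1 + (degree G x + ∑[ i < k ] mates i x)
      ≡⟨ cong₂ (λ a b → a + (b + ∑[ i < k ] mates i x)) (count-singleton x) (≡.sym (degree-count G x)) ⟨
    ∑[ a < 2 + k ] count (part? a)
      ≤⟨ count-disjoint part? disjoint ⟩
    v ∎
    where
    open ≤-Reasoning
    Part : Fin (2 + k) → Fin v → Set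
    Part zero          y = y ≡ x
    Part (suc zero)    y = adj G x y ≡ true
    Part (suc (suc i)) y = y ≢ x × col (C i) y ≡ col (C i) x

    part? : ∀ a → Decidable (Part a)
    part? zero          y = y ≟ x
    part? (suc zero)    y = adj G x y Bool.≟ true
    part? (suc (suc i)) y = ¬? (y ≟ x) ×-dec (col (C i) y ≟ col (C i) x)

    x-non-adjacent : ∀ {y} → y ≡ x → adj G x y ≢ true
    x-non-adjacent refl x~x with () ← trans (≡.sym (irrefl G x)) x~x

    neighbour-non-mate : ∀ {y} i → adj G x y ≡ true → col (C i) y ≢ col (C i) x
    neighbour-non-mate {y} i x~y same = proper (C i) x y x~y (≡.sym same)

    disjoint : ∀ {a b y} → Part a y → Part b y → a ≡ b
    disjoint {zero}        {zero}        _         _          = refl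
    disjoint {zero}        {suc zero}    y≡x       x~y        = ⊥-elim (x-non-adjacent y≡x x~y)
    disjoint {zero}        {suc (suc _)} y≡x       (y≢x , _)  = contradiction y≡x y≢x
    disjoint {suc zero}    {zero}        x~y       y≡x        = ⊥-elim (x-non-adjacent y≡x x~y)
    disjoint {suc zero}    {suc zero}    _         _          = refl
    disjoint {suc zero}    {suc (suc j)} x~y       (_ , same) = ⊥-elim (neighbour-non-mate j x~y same)
    disjoint {suc (suc _)} {zero}        (y≢x , _) y≡x        = contradiction y≡x y≢x
    disjoint {suc (suc i)} {suc zero}    (_ , same) x~y       = ⊥-elim (neighbour-non-mate i x~y same)
    disjoint {suc (suc i)} {suc (suc j)} {y} (y≢x , same-i) (_ , same-j) with i ≟ j
    ... | yes i≡j = cong (λ l → suc (suc l)) i≡j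
    ... | no i≢j  = contradiction same-j (orth i j i≢j y x y≢x same-i)

  local-bound : 2 ≤ k → ∀ x → degree G x + 1 + k * (v ∸ (n ∸ 1) * n ∸ 1) ≤ v
  local-bound 2≤k x = begin
    degree G x + 1 + k * L                ≡⟨ cong (degree G x + 1 +_) (∑-const k L) ⟨
    degree G x + 1 + ∑[ i < k ] L         ≤⟨ +-monoʳ-≤ (degree G x + 1) (∑-mono-≤ mates-large) ⟩
    degree G x + 1 + ∑[ i < k ] mates i x ≤⟨ packing x ⟩
    v                                     ∎
    where
    open ≤-Reasoning
    L : ℕ
    L = v ∸ (n ∸ 1) * n ∸ 1
    mates-large : ∀ i → L ≤ mates i x
    mates-large i with partner 2≤k i
    ... | j , i≢j = mates≥ i≢j x

  maxDegree-bound : 2 ≤ k → 0 < v → maxDegree G + 1 + k * (v ∸ (n ∸ 1) * n ∸ 1) ≤ v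
  maxDegree-bound 2≤k 0<v with maxDegree-attained G 0<v
  ... | x , Δ≤deg = ≤-trans (+-monoˡ-≤ _ (+-monoˡ-≤ 1 Δ≤deg)) (local-bound 2≤k x)

pred-times : ∀ n → (n ∸ 1) * n ≡ n * n ∸ n
pred-times n = trans (*-distribʳ-∸ n n 1) (cong (n * n ∸_) (*-identityˡ n))

order-split : ∀ n m → m ≤ n → n * n ∸ m ≡ (n * n ∸ n) + (n ∸ m)
order-split n m m≤n = begin
  n * n ∸ m                ≡⟨ cong (_∸ m) (m∸n+n≡m (n≤n*n n)) ⟨
  (n * n ∸ n) + n ∸ m      ≡⟨ +-∸-assoc (n * n ∸ n) m≤n ⟩
  (n * n ∸ n) + (n ∸ m)    ∎
  where
  open ≡-Reasoning
  n≤n*n : ∀ n → n ≤ n * n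
  n≤n*n zero    = z≤n
  n≤n*n (suc n) = m≤m*n (suc n) (suc n)

-- Hence the colour class of a vertex, minus the vertex, has at least
-- n² − m − (n − 1)n − 1 = n − m − 1 elements.
order-excess : ∀ n m → m ≤ n → n * n ∸ m ∸ (n ∸ 1) * n ∸ 1 ≡ n ∸ m ∸ 1
order-excess n m m≤n = cong (_∸ 1) (begin
  n * n ∸ m ∸ (n ∸ 1) * n                ≡⟨ cong₂ _∸_ (order-split n m m≤n) (pred-times n) ⟩
  (n * n ∸ n) + (n ∸ m) ∸ (n * n ∸ n)    ≡⟨ m+n∸m≡n (n * n ∸ n) (n ∸ m) ⟩
  n ∸ m                                  ∎)
  where open ≡-Reasoning

≤-div : ∀ {a k L} → 1 ≤ L → k * L ≤ a → k ≤ a div L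
≤-div {a} {k} {suc L} _ kL≤a = begin
  k                   ≡⟨ m*n/n≡m k (suc L) ⟨
  k * suc L / suc L   ≤⟨ /-monoˡ-≤ (suc L) kL≤a ⟩
  a / suc L           ∎
  where open ≤-Reasoning

quotient-bound : ∀ {Δ k L v} → 1 ≤ L → Δ + 1 + k * L ≤ v → k ≤ (v ∸ Δ ∸ 1) div L
quotient-bound {Δ} {k} {L} {v} 1≤L h = ≤-div 1≤L (begin
  k * L           ≤⟨ m+n≤o⇒m≤o∸n (k * L) (≤-trans (≤-reflexive (+-comm (k * L) (Δ + 1))) h) ⟩
  v ∸ (Δ + 1)     ≡⟨ ∸-+-assoc v Δ 1 ⟨
  v ∸ Δ ∸ 1       ∎)
  where open ≤-Reasoning

few-colourings : ∀ {Δ k L P} → 1 ≤ L → P ≤ Δ → Δ + 1 + k * L ≤ P + suc L → k ≤ 1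
few-colourings {k = zero}          _   _   _ = z≤n
few-colourings {k = suc zero}      _   _   _ = s≤s z≤n
few-colourings {Δ} {suc (suc k)} {L} {P} 1≤L P≤Δ h =
  contradiction kL≤L (<⇒≱ (m<m+n L (≤-trans 1≤L (m≤m+n L (k * L)))))
  where
  kL≤L : suc (suc k) * L ≤ L
  kL≤L = +-cancelˡ-≤ (Δ + 1) _ _ (begin
    Δ + 1 + suc (suc k) * L   ≤⟨ h ⟩
    P + suc L                 ≤⟨ +-monoˡ-≤ (suc L) P≤Δ ⟩
    Δ + suc L                 ≡⟨ +-assoc Δ 1 L ⟨
    Δ + 1 + L                 ∎)
    where open ≤-Reasoning

-- Both conclusions of the theorem, from the local inequality, for
-- v = P + d with d ≥ 2 (P = n² − n, d = n − m).
numeric-bounds : ∀ {v P d Δ k} → v ≡ P + d → 2 ≤ d →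
  (2 ≤ k → Δ + 1 + k * (d ∸ 1) ≤ v) →
  (P ≤ Δ → k ≤ 1) × (Δ < P → k ≤ (v ∸ Δ ∸ 1) div (d ∸ 1))
numeric-bounds {k = k} v≡P+d 2≤d local with k ≤? 1
numeric-bounds {P = P} {suc (suc t)} {Δ} refl (s≤s (s≤s _)) local | yes k≤1 =
  (λ _ → k≤1) , (λ Δ<P → ≤-trans k≤1 (quotient-bound (s≤s z≤n) (one-class Δ<P)))
  where
  one-class : Δ < P → Δ + 1 + 1 * suc t ≤ P + suc (suc t)
  one-class Δ<P = +-mono-≤ (≤-trans (≤-reflexive (+-comm Δ 1)) Δ<P)
                           (≤-trans (≤-reflexive (*-identityˡ (suc t))) (n≤1+n (suc t)))
numeric-bounds {d = suc (suc t)} {k = k} refl (s≤s (s≤s _)) local | no k≰1 =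
  (λ P≤Δ → few-colourings (s≤s z≤n) P≤Δ (local 2≤k)) ,
  (λ _ → quotient-bound (s≤s z≤n) (local 2≤k))
  where
  2≤k : 2 ≤ k
  2≤k = ≰⇒> k≰1

theorem1p1 : ∀ (n m : ℕ) → m + 1 < n →
    (G : Graph (n * n ∸ m)) →
    (k : ℕ) (C : Fin k → Coloring G n) → MutuallyOrthogonal C →
      (n * n ∸ n ≤ maxDegree G → k ≤ 1) ×
      (maxDegree G < n * n ∸ n →
        k ≤ (n * n ∸ m ∸ maxDegree G ∸ 1) div (n ∸ m ∸ 1))
theorem1p1 n m m+1<n G k C orth = numeric-bounds v-split 2≤n∸m local
  where
  open OrthogonalFamily C orth

  m≤n : m ≤ n
  m≤n = ≤-trans (m≤m+n m 1) (<⇒≤ m+1<n)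

  v-split : n * n ∸ m ≡ (n * n ∸ n) + (n ∸ m)
  v-split = order-split n m m≤n

  2≤n∸m : 2 ≤ n ∸ m
  2≤n∸m = m+n≤o⇒m≤o∸n 2 (subst (_< n) (+-comm m 1) m+1<n)

  nonempty : 0 < n * n ∸ m
  nonempty = subst (0 <_) (≡.sym v-split) (≤-trans (≤-trans (s≤s z≤n) 2≤n∸m) (m≤n+m _ _))

  local : 2 ≤ k → maxDegree G + 1 + k * (n ∸ m ∸ 1) ≤ n * n ∸ m
  local 2≤k = subst (λ L → maxDegree G + 1 + k * L ≤ n * n ∸ m)
                    (order-excess n m m≤n) (maxDegree-bound 2≤k nonempty)
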